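{- Let $G=(V,E)$ be a graph of order $n$ and let $X\subseteq V$ be a set of vertices such that $G-X$ is connected. If an optimal ordering $\alpha$ of $G$ satisfies $\{\alpha^{ -1}(1),\alpha^{ -1}(n)\}\subseteq V(G-X)$, then $$\mathrm{prf}_{\alpha}(G,V\setminus X)\ \ge\ \mathrm{prf}_{\alpha_X}(G-X)+|X|.$$
   Context: An ordering of a graph $G=(V,E)$ is a bijection $\alpha:V\to\{1,\dots,|V|\}$. For $v\in V$, $N(v)=\{u\in V: uv\in E\}$ and $N[v]=N(v)\cup\{v\}$. The profile of a vertex $z$ in $\alpha$ is $\mathrm{prf}_\alpha(G,z)=\alpha(z)-\min\{\alpha(w): w\in N[z]\}$; for $Z\subseteq V$, $\mathrm{prf}_\alpha(G,Z)=\sum_{z\in Z}\mathrm{prf}_\alpha(G,z)$; and $\mathrm{prf}_\alpha(G)=\mathrm{prf}_\alpha(G,V)$. An ordering $\alpha$ is optimal if $\mathrm{prf}_\alpha(G)$ is minimum over all orderings of $G$; this minimum is the profile $\mathrm{prf}(G)$. For $X\subseteq V$, $\alpha_X$ denotes the ordering of $G-X$ with $\alpha_X(u)<\alpha_X(v)$ iff $\alpha(u)<\alpha(v)$ for all $u,v\in V\setminus X$. -}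

module Defs where

open import Data.Nat using (ℕ; zero; suc; _+_; _∸_; _⊓_; _≤_; _≤ᵇ_)
open import Data.Fin using (Fin; toℕ)
open import Data.Fin.Subset using (Subset)
open import Data.Fin.Permutation using (Permutation′; _⟨$⟩ʳ_)
open import Data.Bool using (Bool; true; false; not; _∧_; if_then_else_)
open import Data.List using (List; foldr; map; allFin)
open import Data.Nat.ListAction using (sum)
open import Data.Vec using (lookup)
open import Relation.Binary.PropositionalEquality using (_≡_)

record Graph (n : ℕ) : Set where
  field
    adj    : Fin n → Fin n → Bool
    sym    : ∀ u v → adj u v ≡ adj v u
    irrefl : ∀ v → adj v v ≡ false
open Graph public

-- An ordering of G: a bijection V → {1..n}; we use Fin n (0-based,
-- i.e. positions shifted by 1, which does not affect profiles).
Ordering : ℕ → Set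
Ordering n = Permutation′ n

pos : ∀ {n} → Ordering n → Fin n → ℕ
pos α v = toℕ (α ⟨$⟩ʳ v)

-- A vertex set given by its characteristic function (V(H) for an induced
-- subgraph H of G).
VSet : ℕ → Set
VSet n = Fin n → Bool

allV : ∀ {n} → VSet n
allV _ = true

notIn : ∀ {n} → Subset n → VSet n
notIn X v = not (lookup X v)

-- min { f w : w ∈ N_H[z] } where H = G[S] is the subgraph induced by S
-- (z itself is always included).
minClosedNbr : ∀ {n} → Graph n → VSet n → (Fin n → ℕ) → Fin n → ℕ
minClosedNbr {n} G S f z =
  foldr (λ w m → if (adj G z w ∧ S w) then (f w ⊓ m) else m) (f z) (allFin n)

prfV : ∀ {n} → Graph n → VSet n → (Fin n → ℕ) → Fin n → ℕ
prfV G S f z = f z ∸ minClosedNbr G S f z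

prfSet : ∀ {n} → Graph n → VSet n → (Fin n → ℕ) → VSet n → ℕ
prfSet {n} G S f Z = sum (map (λ z → if Z z then prfV G S f z else 0) (allFin n))

prf : ∀ {n} → Graph n → Ordering n → ℕ
prf G α = prfSet G allV (pos α) allV

Optimal : ∀ {n} → Graph n → Ordering n → Set
Optimal G α = ∀ β → prf G α ≤ prf G β

-- α_X : the order-preserving ordering of G - X induced by α:
-- α_X(u) = #{ v ∈ V \ X : α(v) ≤ α(u) }  (1-based positions in V \ X).
restrict : ∀ {n} → Ordering n → Subset n → Fin n → ℕ
restrict {n} α X u =
  sum (map (λ v → if (notIn X v ∧ (pos α v ≤ᵇ pos α u)) then 1 else 0) (allFin n))

data Walk {n} (G : Graph n) (S : VSet n) : Fin n → Fin n → Set where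
  here : ∀ {u} → S u ≡ true → Walk G S u u
  step : ∀ {u w v} → S u ≡ true → adj G u w ≡ true → Walk G S w v → Walk G S u v

InducedConnected : ∀ {n} → Graph n → VSet n → Set
InducedConnected G S = ∀ u v → S u ≡ true → S v ≡ true → Walk G S u v

{-# OPTIONS --safe #-}
module Submission where

-- For z ∈ V ∖ X let m(z) be the least α-position in N_{G-X}[z]. The profile of z in
-- α_X is at most the number of vertices of G - X whose α-position lies in the window
-- (m(z), α(z)], while prf_α(G, z) ≥ α(z) - m(z) is at least the number of all vertices
-- in that window. So it suffices that every x ∈ X lies in some window: a walk in G - X
-- from the first to the last vertex of α has an edge uw with α(u) < α(x) ≤ α(w), and
-- then x lies in the window of w.

open import Defs
open import Data.Nat using (ℕ; zero; suc; pred; _+_; _∸_; _⊓_; _≤_; _<_; _≥_; _≤ᵇ_; _<ᵇ_; _≡ᵇ_; z≤n; _≤?_; _<?_)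
open import Data.Nat.Properties
open import Data.Fin using (Fin; zero; suc; toℕ; fromℕ<)
open import Data.Fin.Properties using (toℕ<n; toℕ-fromℕ<)
open import Data.Fin.Subset using (Subset; ∣_∣)
open import Data.Fin.Permutation using (_⟨$⟩ʳ_; _⟨$⟩ˡ_; inverseʳ)
open import Data.Vec using (lookup; []; _∷_)
open import Data.Bool using (Bool; true; false; not; _∧_; if_then_else_; T)
open import Data.Bool.Properties using (T-∧; T-≡)
open import Data.Unit using (tt)
open import Data.Empty using (⊥-elim)
open import Data.Product using (_×_; _,_; ∃-syntax; ∃₂)
open import Data.Sum using (_⊎_; inj₁; inj₂; map₂)
open import Data.List using (List; []; _∷_; foldr; map; allFin; tabulate)
open import Data.List.Properties using (map-tabulate)
open import Data.List.Membership.Propositional using (_∈_)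
open import Data.List.Membership.Propositional.Properties using (∈-allFin)
open import Data.List.Relation.Unary.Any using (here; there)
import Data.Nat.ListAction as List
open import Function using (_∘_; id)
open import Function.Bundles using (Equivalence)
open import Relation.Nullary using (¬_; yes; no)
open import Relation.Binary.PropositionalEquality as ≡ using (_≡_; refl; trans; cong; cong₂; subst)
open import Algebra.Properties.CommutativeMonoid.Sum +-0-commutativeMonoid
  using (sum; sum-cong-≗; sum-replicate-zero; sum-remove; ∑-distrib-+; ∑-comm; sum-permute)

T-∧⁻ : ∀ {a b} → T (a ∧ b) → T a × T b
T-∧⁻ = Equivalence.to T-∧

T-∧⁺ : ∀ {a b} → T a × T b → T (a ∧ b)
T-∧⁺ = Equivalence.from T-∧

≡true⇒T : ∀ {a} → a ≡ true → T a
≡true⇒T = Equivalence.from T-≡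

_∈⟨_,_] : ℕ → ℕ → ℕ → Bool
t ∈⟨ a , b ] = (a <ᵇ t) ∧ (t ≤ᵇ b)

∈⟨⟩⁻ : ∀ {t a b} → T (t ∈⟨ a , b ]) → a < t × t ≤ b
∈⟨⟩⁻ {t} {a} {b} t∈ = let (a<t , t≤b) = T-∧⁻ t∈ in <ᵇ⇒< a t a<t , ≤ᵇ⇒≤ t b t≤b

∈⟨⟩⁺ : ∀ {t a b} → a < t → t ≤ b → T (t ∈⟨ a , b ])
∈⟨⟩⁺ a<t t≤b = T-∧⁺ (<⇒<ᵇ a<t , ≤⇒≤ᵇ t≤b)

sum-mono-≤ : ∀ {n} {f g : Fin n → ℕ} → (∀ i → f i ≤ g i) → sum f ≤ sum g
sum-mono-≤ {zero}  f≤g = z≤n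
sum-mono-≤ {suc n} f≤g = +-mono-≤ (f≤g zero) (sum-mono-≤ (f≤g ∘ suc))

term≤sum : ∀ {n} (f : Fin n → ℕ) i → f i ≤ sum f
term≤sum {suc n} f i = ≤-trans (m≤m+n (f i) _) (≤-reflexive (≡.sym (sum-remove {i = i} f)))

sum-allFin : ∀ {n} (f : Fin n → ℕ) → List.sum (map f (allFin n)) ≡ sum f
sum-allFin f = trans (cong List.sum (map-tabulate id f)) (sum-tabulate f)
  where
  sum-tabulate : ∀ {n} (f : Fin n → ℕ) → List.sum (tabulate f) ≡ sum f
  sum-tabulate {zero}  f = refl
  sum-tabulate {suc n} f = cong (f zero +_) (sum-tabulate (f ∘ suc))

indicator : Bool → ℕ
indicator b = if b then 1 else 0

indicator-mono : ∀ {a b} → (T a → T b) → indicator a ≤ indicator b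
indicator-mono {false}         _   = z≤n
indicator-mono {true}  {true}  _   = ≤-refl
indicator-mono {true}  {false} a⇒b = ⊥-elim (a⇒b tt)

indicator-⊆-+ : ∀ {a b c} → (T a → T b ⊎ T c) → indicator a ≤ indicator b + indicator c
indicator-⊆-+ {false} _ = z≤n
indicator-⊆-+ {true}  a⇒b∨c with a⇒b∨c tt
... | inj₁ tb = ≤-trans (indicator-mono {true} (λ _ → tb)) (m≤m+n _ _)
... | inj₂ tc = ≤-trans (indicator-mono {true} (λ _ → tc)) (m≤n+m _ _)

count : ∀ {n} → (Fin n → Bool) → ℕ
count P = sum (indicator ∘ P)

∣p∣≡count : ∀ {n} (X : Subset n) → ∣ X ∣ ≡ count (lookup X)
∣p∣≡count []          = refl
∣p∣≡count (true ∷ X)  = cong suc (∣p∣≡count X)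
∣p∣≡count (false ∷ X) = ∣p∣≡count X

count-mono : ∀ {n} {P Q : Fin n → Bool} → (∀ i → T (P i) → T (Q i)) → count P ≤ count Q
count-mono P⇒Q = sum-mono-≤ (λ i → indicator-mono (P⇒Q i))

count-none : ∀ {n} {P : Fin n → Bool} → (∀ i → ¬ T (P i)) → count P ≤ 0
count-none {n} P-empty = ≤-trans (count-mono P-empty) (≤-reflexive (sum-replicate-zero n))

count-⊆-+ : ∀ {n} {P Q R : Fin n → Bool} → (∀ i → T (P i) → T (Q i) ⊎ T (R i)) →
            count P ≤ count Q + count R
count-⊆-+ {Q = Q} {R} P⇒Q∨R = ≤-trans (sum-mono-≤ (λ i → indicator-⊆-+ (P⇒Q∨R i)))
                                      (≤-reflexive (∑-distrib-+ (indicator ∘ Q) (indicator ∘ R)))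

count-partition : ∀ {n} (S P : Fin n → Bool) →
                  count (λ i → not (S i) ∧ P i) + count (λ i → S i ∧ P i) ≡ count P
count-partition S P =
  trans (≡.sym (∑-distrib-+ (λ i → indicator (not (S i) ∧ P i)) (λ i → indicator (S i ∧ P i))))
        (sum-cong-≗ split)
  where
  split : ∀ i → indicator (not (S i) ∧ P i) + indicator (S i ∧ P i) ≡ indicator (P i)
  split i with S i
  ... | true  = refl
  ... | false = +-identityʳ _

indicator≤count : ∀ {n a} {P : Fin n → Bool} → (T a → ∃[ i ] T (P i)) → indicator a ≤ count P
indicator≤count {a = false} _ = z≤n
indicator≤count {a = true} {P} witness with witness tt
... | i , Pi = ≤-trans (indicator-mono {true} (λ _ → Pi)) (term≤sum (indicator ∘ P) i)

count-if : ∀ {n} b (P : Fin n → Bool) {x y} → x + count P ≤ y →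
           (if b then x else 0) + count (λ i → b ∧ P i) ≤ (if b then y else 0)
count-if true  P x+P≤y = x+P≤y
count-if {n} false P _ = ≤-reflexive (sum-replicate-zero n)

count-toℕ≡ : ∀ n c → count {n} (λ i → toℕ i ≡ᵇ c) ≤ 1
count-toℕ≡ zero    c       = z≤n
count-toℕ≡ (suc n) zero    = ≤-reflexive (cong suc (sum-replicate-zero n))
count-toℕ≡ (suc n) (suc c) = count-toℕ≡ n c

count-∈⟨⟩-length : ∀ n a k → count {n} (λ i → toℕ i ∈⟨ a , a + k ]) ≤ k
count-∈⟨⟩-length n a zero = count-none {n} {λ i → toℕ i ∈⟨ a , a + 0 ]} λ i t∈ →
  let (a<t , t≤a+0) = ∈⟨⟩⁻ {toℕ i} t∈ in <⇒≱ a<t (≤-trans t≤a+0 (≤-reflexive (+-identityʳ a)))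
count-∈⟨⟩-length n a (suc k) = begin
    count {n} (λ i → toℕ i ∈⟨ a , a + suc k ])
  ≤⟨ count-⊆-+ last-or-below ⟩
    count {n} (λ i → toℕ i ∈⟨ a , a + k ]) + count {n} (λ i → toℕ i ≡ᵇ a + suc k)
  ≤⟨ +-mono-≤ (count-∈⟨⟩-length n a k) (count-toℕ≡ n (a + suc k)) ⟩
    k + 1
  ≡⟨ +-comm k 1 ⟩
    suc k
  ∎
  where
  open ≤-Reasoning
  last-or-below : ∀ (i : Fin n) → T (toℕ i ∈⟨ a , a + suc k ]) →
                  T (toℕ i ∈⟨ a , a + k ]) ⊎ T (toℕ i ≡ᵇ a + suc k)
  last-or-below i t∈ with ∈⟨⟩⁻ {toℕ i} t∈
  ... | a<t , t≤a+1+k with m≤n⇒m<n∨m≡n t≤a+1+k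
  ...   | inj₁ t<a+1+k = inj₁ (∈⟨⟩⁺ a<t (m<1+n⇒m≤n (subst (toℕ i <_) (+-suc a k) t<a+1+k)))
  ...   | inj₂ t≡a+1+k = inj₂ (≡⇒≡ᵇ _ _ t≡a+1+k)

count-∈⟨⟩ : ∀ n a b → count {n} (λ i → toℕ i ∈⟨ a , b ]) ≤ b ∸ a
count-∈⟨⟩ n a b with a ≤? b
... | yes a≤b = subst (λ c → count {n} (λ i → toℕ i ∈⟨ a , c ]) ≤ b ∸ a) (m+[n∸m]≡n a≤b)
                      (count-∈⟨⟩-length n a (b ∸ a))
... | no  a≰b = ≤-trans (count-none {n} {λ i → toℕ i ∈⟨ a , b ]} λ i t∈ →
                  let (a<t , t≤b) = ∈⟨⟩⁻ {toℕ i} t∈ in a≰b (<⇒≤ (<-≤-trans a<t t≤b))) z≤n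

count-pos-∈⟨⟩ : ∀ {n} (α : Ordering n) a b → count (λ v → pos α v ∈⟨ a , b ]) ≤ b ∸ a
count-pos-∈⟨⟩ {n} α a b = ≤-trans (≤-reflexive (≡.sym (sum-permute _ α))) (count-∈⟨⟩ n a b)

pos-surjective : ∀ {n} (α : Ordering n) {i} → i < n → ∃[ v ] pos α v ≡ i
pos-surjective α i<n = α ⟨$⟩ˡ fromℕ< i<n , trans (cong toℕ (inverseʳ α)) (toℕ-fromℕ< i<n)

module _ {A : Set} (P : A → Bool) (f : A → ℕ) (d : ℕ) where

  minWhere : List A → ℕ
  minWhere = foldr (λ w m → if P w then f w ⊓ m else m) d

  minWhere≤seed : ∀ ws → minWhere ws ≤ d
  minWhere≤seed []       = ≤-refl
  minWhere≤seed (w ∷ ws) with P w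
  ... | true  = ≤-trans (m⊓n≤n _ _) (minWhere≤seed ws)
  ... | false = minWhere≤seed ws

  minWhere≤ : ∀ {w ws} → w ∈ ws → T (P w) → minWhere ws ≤ f w
  minWhere≤ {w} (here refl) Pw with P w
  ... | true  = m⊓n≤m _ _
  ... | false = ⊥-elim Pw
  minWhere≤ {ws = w′ ∷ _} (there w∈ws) Pw with P w′
  ... | true  = ≤-trans (m⊓n≤n _ _) (minWhere≤ w∈ws Pw)
  ... | false = minWhere≤ w∈ws Pw

  minWhere-sel : ∀ ws → minWhere ws ≡ d ⊎ ∃[ w ] T (P w) × minWhere ws ≡ f w
  minWhere-sel []       = inj₁ refl
  minWhere-sel (w ∷ ws) with P w in Pw≡true
  ... | false = minWhere-sel ws
  ... | true with ⊓-sel (f w) (minWhere ws)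
  ...   | inj₁ min≡fw = inj₂ (w , ≡true⇒T Pw≡true , min≡fw)
  ...   | inj₂ min≡rest with minWhere-sel ws
  ...     | inj₁ rest≡d             = inj₁ (trans min≡rest rest≡d)
  ...     | inj₂ (w′ , Pw′ , rest≡fw′) = inj₂ (w′ , Pw′ , trans min≡rest rest≡fw′)

ClosedNbr : ∀ {n} → Graph n → VSet n → Fin n → Fin n → Set
ClosedNbr G S z w = w ≡ z ⊎ T (adj G z w ∧ S w)

minClosedNbr≤ : ∀ {n} (G : Graph n) S f {z w} → ClosedNbr G S z w → minClosedNbr G S f z ≤ f w
minClosedNbr≤ {n} G S f (inj₁ refl) = minWhere≤seed _ f _ (allFin n)
minClosedNbr≤     G S f (inj₂ zw)   = minWhere≤ _ f _ (∈-allFin _) zw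

minClosedNbr-attained : ∀ {n} (G : Graph n) S f z →
                        ∃[ w ] ClosedNbr G S z w × minClosedNbr G S f z ≡ f w
minClosedNbr-attained {n} G S f z with minWhere-sel (λ w → adj G z w ∧ S w) f (f z) (allFin n)
... | inj₁ min≡fz            = z , inj₁ refl , min≡fz
... | inj₂ (w , zw , min≡fw) = w , inj₂ zw , min≡fw

minClosedNbr-antitone : ∀ {n} (G : Graph n) {S S′} f z → (∀ w → T (S w) → T (S′ w)) →
                        minClosedNbr G S′ f z ≤ minClosedNbr G S f z
minClosedNbr-antitone G {S} {S′} f z S⊆S′ with minClosedNbr-attained G S f z
... | w , zw , min≡fw = subst (_ ≤_) (≡.sym min≡fw) (minClosedNbr≤ G S′ f (map₂ widen zw))
  where
  widen : T (adj G z w ∧ S w) → T (adj G z w ∧ S′ w)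
  widen zw = let (adj-zw , Sw) = T-∧⁻ zw in T-∧⁺ (adj-zw , S⊆S′ w Sw)

walk-start∈ : ∀ {n} {G : Graph n} {S u v} → Walk G S u v → S u ≡ true
walk-start∈ (here Su)     = Su
walk-start∈ (step Su _ _) = Su

walk-crossingEdge : ∀ {n} {G : Graph n} {S : VSet n} (f : Fin n → ℕ) {q u v} →
                    Walk G S u v → f u < q → q ≤ f v →
                    ∃₂ λ u′ w′ → S u′ ≡ true × S w′ ≡ true × adj G u′ w′ ≡ true × f u′ < q × q ≤ f w′
walk-crossingEdge f (here _) fu<q q≤fu = ⊥-elim (<⇒≱ fu<q q≤fu)
walk-crossingEdge f {q} (step {w = w} Su uw rest) fu<q q≤fv with f w <? q
... | yes fw<q = walk-crossingEdge f rest fw<q q≤fv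
... | no  fw≮q = _ , w , Su , walk-start∈ rest , uw , fu<q , ≮⇒≥ fw≮q

module _ {n} (G : Graph n) (X : Subset n) (α : Ordering n) where

  window : Fin n → Fin n → Bool
  window z v = pos α v ∈⟨ minClosedNbr G (notIn X) (pos α) z , pos α z ]

  charges : Fin n → Fin n → Bool
  charges z x = notIn X z ∧ (lookup X x ∧ window z x)

  restrict≡count : ∀ u → restrict α X u ≡ count (λ v → notIn X v ∧ (pos α v ≤ᵇ pos α u))
  restrict≡count u = sum-allFin (λ v → indicator (notIn X v ∧ (pos α v ≤ᵇ pos α u)))

  restrict≤ : ∀ z w → restrict α X z ≤
              restrict α X w + count (λ v → notIn X v ∧ pos α v ∈⟨ pos α w , pos α z ])
  restrict≤ z w = begin
      restrict α X z
    ≡⟨ restrict≡count z ⟩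
      count (λ v → notIn X v ∧ (pos α v ≤ᵇ pos α z))
    ≤⟨ count-⊆-+ below-or-between ⟩
      count (λ v → notIn X v ∧ (pos α v ≤ᵇ pos α w)) + count between
    ≡⟨ cong (_+ count between) (≡.sym (restrict≡count w)) ⟩
      restrict α X w + count between
    ∎
    where
    open ≤-Reasoning
    between : Fin n → Bool
    between v = notIn X v ∧ pos α v ∈⟨ pos α w , pos α z ]
    below-or-between : ∀ v → T (notIn X v ∧ (pos α v ≤ᵇ pos α z)) →
                       T (notIn X v ∧ (pos α v ≤ᵇ pos α w)) ⊎ T (between v)
    below-or-between v v≤z with T-∧⁻ v≤z | pos α v ≤? pos α w
    ... | v∉X , _    | yes v≤w = inj₁ (T-∧⁺ (v∉X , ≤⇒≤ᵇ v≤w))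
    ... | v∉X , v≤z′ | no  v≰w = inj₂ (T-∧⁺ (v∉X , ∈⟨⟩⁺ (≰⇒> v≰w) (≤ᵇ⇒≤ _ _ v≤z′)))

  prfV-restrict≤count-window : ∀ z →
    prfV G (notIn X) (restrict α X) z ≤ count (λ v → notIn X v ∧ window z v)
  prfV-restrict≤count-window z with minClosedNbr-attained G (notIn X) (restrict α X) z
  ... | w , zw , min≡rw = begin
      restrict α X z ∸ minClosedNbr G (notIn X) (restrict α X) z
    ≡⟨ cong (restrict α X z ∸_) min≡rw ⟩
      restrict α X z ∸ restrict α X w
    ≤⟨ m≤n+o⇒m∸n≤o (restrict α X z) _ (restrict≤ z w) ⟩
      count (λ v → notIn X v ∧ pos α v ∈⟨ pos α w , pos α z ])
    ≤⟨ count-mono widen ⟩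
      count (λ v → notIn X v ∧ window z v)
    ∎
    where
    open ≤-Reasoning
    widen : ∀ v → T (notIn X v ∧ pos α v ∈⟨ pos α w , pos α z ]) → T (notIn X v ∧ window z v)
    widen v v∈ = let (v∉X , between) = T-∧⁻ {notIn X v} v∈
                     (w<v , v≤z) = ∈⟨⟩⁻ {pos α v} between
                 in T-∧⁺ (v∉X , ∈⟨⟩⁺ (≤-<-trans (minClosedNbr≤ G (notIn X) (pos α) zw) w<v) v≤z)

  count-window≤prfV : ∀ z → count (window z) ≤ prfV G allV (pos α) z
  count-window≤prfV z = ≤-trans (count-pos-∈⟨⟩ α _ (pos α z))
    (∸-monoʳ-≤ (pos α z) (minClosedNbr-antitone G (pos α) z (λ _ _ → tt)))

  prfV-restrict+charged≤prfV : ∀ z →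
    prfV G (notIn X) (restrict α X) z + count (λ x → lookup X x ∧ window z x) ≤ prfV G allV (pos α) z
  prfV-restrict+charged≤prfV z = begin
      prfV G (notIn X) (restrict α X) z + count (λ x → lookup X x ∧ window z x)
    ≤⟨ +-monoˡ-≤ _ (prfV-restrict≤count-window z) ⟩
      count (λ v → notIn X v ∧ window z v) + count (λ x → lookup X x ∧ window z x)
    ≡⟨ count-partition (lookup X) (window z) ⟩
      count (window z)
    ≤⟨ count-window≤prfV z ⟩
      prfV G allV (pos α) z
    ∎
    where open ≤-Reasoning

  crossingEdge-window : ∀ {u w x} → notIn X u ≡ true → adj G u w ≡ true →
                        pos α u < pos α x → pos α x ≤ pos α w → T (window w x)
  crossingEdge-window {u} {w} u∉X uw u<x x≤w = ∈⟨⟩⁺ (≤-<-trans min≤u u<x) x≤w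
    where
    min≤u : minClosedNbr G (notIn X) (pos α) w ≤ pos α u
    min≤u = minClosedNbr≤ G (notIn X) (pos α)
              (inj₂ (T-∧⁺ (≡true⇒T (trans (Graph.sym G w u) uw) , ≡true⇒T u∉X)))

  charges-cover : InducedConnected G (notIn X) →
                  (∀ v → pos α v ≡ 0 → lookup X v ≡ false) →
                  (∀ v → suc (pos α v) ≡ n → lookup X v ≡ false) →
                  ∀ x → T (lookup X x) → ∃[ z ] T (charges z x)
  charges-cover connected first∉X last∉X x x∈X =
    charged-by-crossing (pos-surjective α 0<n) (pos-surjective α pred<n)
    where
    0<x : 0 < pos α x
    0<x = n≢0⇒n>0 (λ x≡0 → subst T (first∉X x x≡0) x∈X)
    0<n : 0 < n
    0<n = <-trans 0<x (toℕ<n (α ⟨$⟩ʳ x))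
    suc-pred≡n : suc (pred n) ≡ n
    suc-pred≡n = m+[n∸m]≡n 0<n
    pred<n : pred n < n
    pred<n = ≤-reflexive suc-pred≡n
    charged-by-crossing : ∃[ v ] pos α v ≡ 0 → ∃[ v ] pos α v ≡ pred n → ∃[ z ] T (charges z x)
    charged-by-crossing (first , first≡0) (last , last≡pred) =
      let (u , w , u∉X , w∉X , uw , u<x , x≤w) =
            walk-crossingEdge (pos α)
              (connected first last (cong not (first∉X first first≡0))
                                    (cong not (last∉X last (trans (cong suc last≡pred) suc-pred≡n))))
              (subst (_< pos α x) (≡.sym first≡0) 0<x)
              (subst (pos α x ≤_) (≡.sym last≡pred) (<⇒≤pred (toℕ<n (α ⟨$⟩ʳ x))))
      in w , T-∧⁺ (≡true⇒T w∉X , T-∧⁺ (x∈X , crossingEdge-window u∉X uw u<x x≤w))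

lemma2p1 : ∀ {n} (G : Graph n) (X : Subset n) (α : Ordering n)
    → InducedConnected G (notIn X)
    → Optimal G α
    → (∀ v → pos α v ≡ 0 → lookup X v ≡ false)
    → (∀ v → suc (pos α v) ≡ n → lookup X v ≡ false)
    → prfSet G allV (pos α) (notIn X) ≥ prfSet G (notIn X) (restrict α X) (notIn X) + ∣ X ∣
lemma2p1 {n} G X α connected _ first∉X last∉X = begin
    prfSet G S r S + ∣ X ∣
  ≡⟨ cong₂ _+_ (sum-allFin B) (∣p∣≡count X) ⟩
    sum B + count (lookup X)
  ≤⟨ +-monoʳ-≤ (sum B) (sum-mono-≤ λ x →
       indicator≤count (charges-cover G X α connected first∉X last∉X x)) ⟩
    sum B + sum (λ x → count (λ z → charges G X α z x))
  ≡⟨ cong (sum B +_) (∑-comm (λ x z → indicator (charges G X α z x))) ⟩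
    sum B + sum (λ z → count (charges G X α z))
  ≡⟨ ≡.sym (∑-distrib-+ B _) ⟩
    sum (λ z → B z + count (charges G X α z))
  ≤⟨ sum-mono-≤ (λ z → count-if (S z) (λ x → lookup X x ∧ window G X α z x)
                                  (prfV-restrict+charged≤prfV G X α z)) ⟩
    sum A
  ≡⟨ ≡.sym (sum-allFin A) ⟩
    prfSet G allV (pos α) S
  ∎
  where
  open ≤-Reasoning
  S : VSet n
  S = notIn X
  r : Fin n → ℕ
  r = restrict α X
  A B : Fin n → ℕ
  A z = if S z then prfV G allV (pos α) z else 0
  B z = if S z then prfV G S r z else 0
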